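{- Let $G$ be a connected graph that is not isomorphic to $K_2$ or to $C_5$. Then $G$ has three pairwise disjoint isolating sets.
   Context: All graphs are finite and simple. For a set $X$ of vertices, $N[X]$ denotes the closed neighborhood of $X$ ($X$ together with all vertices adjacent to a vertex of $X$). An isolating set of $G$ is a set $X \subseteq V(G)$ such that $G - N[X]$ has no edge (equivalently, every edge of $G$ is incident with a vertex of $N[X]$). Isolating sets are not required to be minimum. -}

module Defs where

open import Data.Nat using (ℕ; suc)
open import Data.Fin using (Fin; zero; suc)
open import Data.Fin.Subset using (Subset; _∈_)
open import Data.Product using (Σ; ∃; _×_; _,_)
open import Data.Sum using (_⊎_)
open import Data.Empty using (⊥)
open import Relation.Nullary using (¬_)
import Data.Fin
open import Relation.Binary.PropositionalEquality using (_≡_; _≢_)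
open import Function.Bundles using (_⤖_; Bijection)

record Graph (n : ℕ) : Set₁ where
  field
    Adj     : Fin n → Fin n → Set
    irrefl  : ∀ x → ¬ Adj x x
    sym     : ∀ {x y} → Adj x y → Adj y x
    adj?    : ∀ x y → Adj x y ⊎ ¬ Adj x y
open Graph public

data Walk {n : ℕ} (G : Graph n) : Fin n → Fin n → Set where
  here : ∀ {x} → Walk G x x
  step : ∀ {x y z} → Adj G x y → Walk G y z → Walk G x z

Connected : ∀ {n} → Graph n → Set
Connected G = ∀ x y → Walk G x y

record _≅_ {n m : ℕ} (G : Graph n) (H : Graph m) : Set where
  field
    bij  : Fin n ⤖ Fin m
    pres : ∀ x y → (Adj G x y → Adj H (Bijection.to bij x) (Bijection.to bij y))
                 × (Adj H (Bijection.to bij x) (Bijection.to bij y) → Adj G x y)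

K₂ : Graph 2
K₂ = record { Adj = λ x y → x ≢ y ; irrefl = λ x p → p _≡_.refl
            ; sym = λ p q → p (symm q) ; adj? = dec }
  where
  symm : ∀ {x y : Fin 2} → x ≡ y → y ≡ x
  symm _≡_.refl = _≡_.refl
  dec : ∀ (x y : Fin 2) → x ≢ y ⊎ ¬ (x ≢ y)
  dec zero zero = _⊎_.inj₂ (λ p → p _≡_.refl)
  dec zero (suc zero) = _⊎_.inj₁ (λ ())
  dec (suc zero) zero = _⊎_.inj₁ (λ ())
  dec (suc zero) (suc zero) = _⊎_.inj₂ (λ p → p _≡_.refl)

private
  next : Fin 5 → Fin 5
  next zero = suc zero
  next (suc zero) = suc (suc zero)
  next (suc (suc zero)) = suc (suc (suc zero))
  next (suc (suc (suc zero))) = suc (suc (suc (suc zero)))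
  next (suc (suc (suc (suc zero)))) = zero

  C₅Adj : Fin 5 → Fin 5 → Set
  C₅Adj x y = (y ≡ next x) ⊎ (x ≡ next y)

  C₅irr : ∀ x → ¬ C₅Adj x x
  C₅irr zero (_⊎_.inj₁ ())
  C₅irr zero (_⊎_.inj₂ ())
  C₅irr (suc zero) (_⊎_.inj₁ ())
  C₅irr (suc zero) (_⊎_.inj₂ ())
  C₅irr (suc (suc zero)) (_⊎_.inj₁ ())
  C₅irr (suc (suc zero)) (_⊎_.inj₂ ())
  C₅irr (suc (suc (suc zero))) (_⊎_.inj₁ ())
  C₅irr (suc (suc (suc zero))) (_⊎_.inj₂ ())
  C₅irr (suc (suc (suc (suc zero)))) (_⊎_.inj₁ ())
  C₅irr (suc (suc (suc (suc zero)))) (_⊎_.inj₂ ())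

  C₅sym : ∀ {x y} → C₅Adj x y → C₅Adj y x
  C₅sym (_⊎_.inj₁ p) = _⊎_.inj₂ p
  C₅sym (_⊎_.inj₂ p) = _⊎_.inj₁ p

  C₅dec : ∀ x y → C₅Adj x y ⊎ ¬ C₅Adj x y
  C₅dec x y with y Data.Fin.≟ next x | x Data.Fin.≟ next y
  ... | Relation.Nullary.yes p | _ = _⊎_.inj₁ (_⊎_.inj₁ p)
  ... | Relation.Nullary.no _ | Relation.Nullary.yes q = _⊎_.inj₁ (_⊎_.inj₂ q)
  ... | Relation.Nullary.no p | Relation.Nullary.no q =
        _⊎_.inj₂ λ { (_⊎_.inj₁ r) → p r ; (_⊎_.inj₂ r) → q r }

C₅ : Graph 5
C₅ = record { Adj = C₅Adj ; irrefl = C₅irr ; sym = C₅sym ; adj? = C₅dec }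

InClosedNbhd : ∀ {n} → Graph n → Subset n → Fin n → Set
InClosedNbhd G X v = v ∈ X ⊎ ∃ λ u → u ∈ X × Adj G u v

Isolating : ∀ {n} → Graph n → Subset n → Set
Isolating G X = ∀ u v → Adj G u v → InClosedNbhd G X u ⊎ InClosedNbhd G X v

Disjoint : ∀ {n} → Subset n → Subset n → Set
Disjoint X Y = ∀ v → v ∈ X → v ∈ Y → ⊥

-- Colour every vertex by its depth mod 3, where a depth function only asks each non-root
-- vertex to have a neighbour exactly one level closer to the root. A vertex with a neighbour
-- one level deeper sees all three colours in its closed neighbourhood, so every colour class
-- is isolating unless some edge joins two vertices that both miss a colour. Raising a
-- childless vertex above a neighbour that is at least as deep, or re-rooting at a childless
-- neighbour of the root, increases the sum of depths, so these moves stabilise; in a stable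
-- depth function the only possible bad edge joins the root to a leaf of depth n − 1 ≡ 1
-- (mod 3), and then G has a Hamiltonian cycle with n ≡ 2 (mod 3). For n = 2 this is K₂; for
-- n = 5 it is C₅ unless there is a chord, which makes the residues of cycle positions work.
-- For n ≥ 8, a non-adjacent pair at distance 4 along the cycle is handled by the depths in
-- the spanning tree made of the two arcs between them; otherwise the chords 0–4, 1–5, 2–6
-- give a new Hamiltonian cycle 0, 4, 3, 2, 1, 5, 6, … on which 2–6 is a suitable chord.

module Submission where

open import Defs
open import Data.Bool using (true)
open import Data.Empty using (⊥; ⊥-elim)
open import Data.Fin using (Fin; zero; suc; _≟_; toℕ; fromℕ<)
open import Data.Fin.Patterns using (0F; 1F; 2F)
import Data.Fin.Properties as Fin
open import Data.Fin.Subset using (Subset; _∈_)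
open import Data.Nat using (ℕ; zero; suc; _+_; _∸_; _*_; _≤_; _<_; z≤n; s≤s; _≤?_; _<?_)
import Data.Nat.Properties as ℕ
open import Data.Product using (Σ; ∃; _×_; _,_; proj₁; proj₂)
open import Data.Sum using (_⊎_; inj₁; inj₂; swap; map₂)
open import Data.Vec using (tabulate)
open import Data.Vec.Functional using (updateAt)
open import Data.Vec.Functional.Properties using (updateAt-updates; updateAt-minimal)
import Data.Vec.Properties as Vec
open import Function using (_∘_)
open import Function.Bundles using (mk⤖)
open import Relation.Binary.Definitions using (tri<; tri≈; tri>)
open import Relation.Binary.PropositionalEquality as ≡
  using (_≡_; _≢_; refl; trans; cong; subst; subst₂; module ≡-Reasoning)
open import Relation.Nullary using (¬_; Dec; does; yes; no)
open import Relation.Nullary.Decidable using (dec-true; fromSum; toWitness; ¬?; _×-dec_; _⊎-dec_; _→-dec_)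

open import Algebra.Properties.Monoid.Sum ℕ.+-0-monoid using (sum)

suc₃ : Fin 3 → Fin 3
suc₃ 0F = 1F
suc₃ 1F = 2F
suc₃ 2F = 0F

mod₃ : ℕ → Fin 3
mod₃ zero    = 0F
mod₃ (suc k) = suc₃ (mod₃ k)

suc₃-cases : ∀ c c′ → c′ ≡ c ⊎ c′ ≡ suc₃ c ⊎ c′ ≡ suc₃ (suc₃ c)
suc₃-cases 0F 0F = inj₁ refl
suc₃-cases 0F 1F = inj₂ (inj₁ refl)
suc₃-cases 0F 2F = inj₂ (inj₂ refl)
suc₃-cases 1F 0F = inj₂ (inj₂ refl)
suc₃-cases 1F 1F = inj₁ refl
suc₃-cases 1F 2F = inj₂ (inj₁ refl)
suc₃-cases 2F 0F = inj₂ (inj₁ refl)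
suc₃-cases 2F 1F = inj₂ (inj₂ refl)
suc₃-cases 2F 2F = inj₁ refl

suc₃-injective : ∀ {c c′} → suc₃ c ≡ suc₃ c′ → c ≡ c′
suc₃-injective {0F} {0F} _ = refl
suc₃-injective {1F} {1F} _ = refl
suc₃-injective {2F} {2F} _ = refl
suc₃-injective {0F} {1F} ()
suc₃-injective {0F} {2F} ()
suc₃-injective {1F} {0F} ()
suc₃-injective {1F} {2F} ()
suc₃-injective {2F} {0F} ()
suc₃-injective {2F} {1F} ()

mod₃-3+ : ∀ k → mod₃ (3 + k) ≡ mod₃ k
mod₃-3+ k with mod₃ k
... | 0F = refl
... | 1F = refl
... | 2F = refl

sum-updateAt : ∀ {n} (f : Fin n → ℕ) x h → sum (updateAt f x h) + f x ≡ sum f + h (f x)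
sum-updateAt {suc n} f zero h = begin
  h (f zero) + S + f zero   ≡⟨ ℕ.+-comm (h (f zero) + S) (f zero) ⟩
  f zero + (h (f zero) + S) ≡⟨ cong (f zero +_) (ℕ.+-comm (h (f zero)) S) ⟩
  f zero + (S + h (f zero)) ≡⟨ ℕ.+-assoc (f zero) S _ ⟨
  f zero + S + h (f zero)   ∎
  where
  open ≡-Reasoning
  S = sum (f ∘ suc)
sum-updateAt {suc n} f (suc x) h = begin
  f zero + S′ + f (suc x)      ≡⟨ ℕ.+-assoc (f zero) S′ _ ⟩
  f zero + (S′ + f (suc x))    ≡⟨ cong (f zero +_) (sum-updateAt (f ∘ suc) x h) ⟩
  f zero + (S + h (f (suc x))) ≡⟨ ℕ.+-assoc (f zero) S _ ⟨
  f zero + S + h (f (suc x))   ∎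
  where
  open ≡-Reasoning
  S  = sum (f ∘ suc)
  S′ = sum (updateAt (f ∘ suc) x h)

sum-suc : ∀ {n} (f : Fin n → ℕ) → sum (suc ∘ f) ≡ n + sum f
sum-suc {zero}  f = refl
sum-suc {suc n} f = cong suc (begin
  f zero + sum (suc ∘ f ∘ suc) ≡⟨ cong (f zero +_) (sum-suc (f ∘ suc)) ⟩
  f zero + (n + sum (f ∘ suc)) ≡⟨ ℕ.+-assoc (f zero) n _ ⟨
  f zero + n + sum (f ∘ suc)   ≡⟨ cong (_+ sum (f ∘ suc)) (ℕ.+-comm (f zero) n) ⟩
  n + f zero + sum (f ∘ suc)   ≡⟨ ℕ.+-assoc n (f zero) _ ⟩
  n + (f zero + sum (f ∘ suc)) ∎)
  where open ≡-Reasoning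

sum-≤ : ∀ {n} (f : Fin n → ℕ) k → (∀ i → f i ≤ k) → sum f ≤ n * k
sum-≤ {zero}  f k f≤k = z≤n
sum-≤ {suc n} f k f≤k = ℕ.+-mono-≤ (f≤k zero) (sum-≤ (f ∘ suc) k (f≤k ∘ suc))

m+n≡o+p∧n<p⇒o<m : ∀ {m n o p} → m + n ≡ o + p → n < p → o < m
m+n≡o+p∧n<p⇒o<m {m} eq n<p = ℕ.≰⇒> λ m≤o → ℕ.<⇒≢ (ℕ.+-mono-≤-< m≤o n<p) eq

spend-fuel : ∀ {b fuel s s′} → b < suc fuel + s → s < s′ → b < fuel + s′
spend-fuel {b} {fuel} {s} bound s<s′ =
  ℕ.<-≤-trans (subst (b <_) (≡.sym (ℕ.+-suc fuel s)) bound) (ℕ.+-monoʳ-≤ fuel s<s′)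

least : ∀ {P : ℕ → Set} → (∀ k → Dec (P k)) → ∀ {m} → P m →
        ∃ λ k → P k × (∀ j → P j → k ≤ j)
least P? {zero} p = 0 , p , λ _ _ → z≤n
least P? {suc m} p with P? 0
... | yes p₀ = 0 , p₀ , λ _ _ → z≤n
... | no ¬p₀ with least (P? ∘ suc) p
... | k , pk , minimal = suc k , pk , λ where
  zero    p₀ → ⊥-elim (¬p₀ p₀)
  (suc j) pj → s≤s (minimal j pj)

adj-dec : ∀ {n} (G : Graph n) u v → Dec (Adj G u v)
adj-dec G u v = fromSum (adj? G u v)

adj⇒≢ : ∀ {n} (G : Graph n) {u v} → Adj G u v → u ≢ v
adj⇒≢ G {u} uv refl = irrefl G u uv

DisjointIsolatingTriple : ∀ {n} → Graph n → Set
DisjointIsolatingTriple {n} G =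
  Σ (Subset n) λ A → Σ (Subset n) λ B → Σ (Subset n) λ C →
    Isolating G A × Isolating G B × Isolating G C ×
    Disjoint A B × Disjoint A C × Disjoint B C

module Colourings {n : ℕ} (G : Graph n) where

  Colouring : Set
  Colouring = Fin n → Fin 3

  colourClass : Colouring → Fin 3 → Subset n
  colourClass col c = tabulate λ v → does (col v ≟ c)

  ∈-colourClass⁺ : ∀ col {c v} → col v ≡ c → v ∈ colourClass col c
  ∈-colourClass⁺ col {c} {v} eq = Vec.lookup⇒[]= v _
    (trans (Vec.lookup∘tabulate _ v) (dec-true (col v ≟ c) eq))

  ∈-colourClass⁻ : ∀ col {c v} → v ∈ colourClass col c → col v ≡ c
  ∈-colourClass⁻ col {c} {v} v∈ =
    witness (col v ≟ c) (trans (≡.sym (Vec.lookup∘tabulate _ v)) (Vec.[]=⇒lookup v∈))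
    where
    witness : ∀ {A : Set} (a? : Dec A) → does a? ≡ true → A
    witness (yes a) _ = a

  Sees : Colouring → Fin 3 → Fin n → Set
  Sees col c v = ∃ λ w → (w ≡ v ⊎ Adj G w v) × col w ≡ c

  SeesAll : Colouring → Fin n → Set
  SeesAll col v = ∀ c → Sees col c v

  IsolatingColouring : Colouring → Set
  IsolatingColouring col = ∀ c u v → Adj G u v → Sees col c u ⊎ Sees col c v

  sees-self : ∀ {col c v} → col v ≡ c → Sees col c v
  sees-self {v = v} eq = v , inj₁ refl , eq

  sees-neighbour : ∀ {col c v w} → Adj G w v → col w ≡ c → Sees col c v
  sees-neighbour {w = w} wv eq = w , inj₂ wv , eq

  seesAll-cyclic : ∀ {col v} c → Sees col c v → Sees col (suc₃ c) v → Sees col (suc₃ (suc₃ c)) v →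
                   SeesAll col v
  seesAll-cyclic c s₀ s₁ s₂ c′ with suc₃-cases c c′
  ... | inj₁ refl        = s₀
  ... | inj₂ (inj₁ refl) = s₁
  ... | inj₂ (inj₂ refl) = s₂

  isolating-from-independent-exceptions : ∀ col (Exceptional : Fin n → Set) →
    (∀ v → SeesAll col v ⊎ Exceptional v) →
    (∀ u v → Adj G u v → Exceptional u → Exceptional v → ⊥) → IsolatingColouring col
  isolating-from-independent-exceptions col Exc seesAll-or-exc independent c u v uv
    with seesAll-or-exc u | seesAll-or-exc v
  ... | inj₁ u-sees | _          = inj₁ (u-sees c)
  ... | inj₂ _      | inj₁ v-sees = inj₂ (v-sees c)
  ... | inj₂ u-exc  | inj₂ v-exc  = ⊥-elim (independent u v uv u-exc v-exc)

  sees⇒inClosedNbhd : ∀ {col c v} → Sees col c v → InClosedNbhd G (colourClass col c) v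
  sees⇒inClosedNbhd {col} (w , inj₁ refl , eq) = inj₁ (∈-colourClass⁺ col eq)
  sees⇒inClosedNbhd {col} (w , inj₂ wv , eq)   = inj₂ (w , ∈-colourClass⁺ col eq , wv)

  colourClass-isolating : ∀ {col} → IsolatingColouring col → ∀ c → Isolating G (colourClass col c)
  colourClass-isolating isolating c u v uv with isolating c u v uv
  ... | inj₁ u-sees = inj₁ (sees⇒inClosedNbhd u-sees)
  ... | inj₂ v-sees = inj₂ (sees⇒inClosedNbhd v-sees)

  disjointIsolatingTriple : ∀ {col} → IsolatingColouring col → DisjointIsolatingTriple G
  disjointIsolatingTriple {col} isolating =
    colourClass col 0F , colourClass col 1F , colourClass col 2F ,
    colourClass-isolating isolating 0F , colourClass-isolating isolating 1F ,
    colourClass-isolating isolating 2F ,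
    different (λ ()) , different (λ ()) , different (λ ())
    where
    different : ∀ {c c′} → c ≢ c′ → Disjoint (colourClass col c) (colourClass col c′)
    different c≢c′ v v∈c v∈c′ =
      c≢c′ (trans (≡.sym (∈-colourClass⁻ col v∈c)) (∈-colourClass⁻ col v∈c′))

HasIsolatingColouring : ∀ {n} → Graph n → Set
HasIsolatingColouring G = ∃ (Colourings.IsolatingColouring G)

module Depths {n : ℕ} (G : Graph n) where

  record IsDepth (r : Fin n) (d : Fin n → ℕ) : Set where
    field
      depth-root : d r ≡ 0
      has-parent : ∀ v → v ≢ r → ∃ λ w → Adj G w v × suc (d w) ≡ d v
  open IsDepth

  HasChild : (Fin n → ℕ) → Fin n → Set
  HasChild d v = ∃ λ w → Adj G v w × d w ≡ suc (d v)

  hasChild? : ∀ d v → Dec (HasChild d v)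
  hasChild? d v = Fin.any? λ w → adj-dec G v w ×-dec (d w ℕ.≟ suc (d v))

  childless-not-parent : ∀ {d u w v} → ¬ HasChild d u → Adj G w v → suc (d w) ≡ d v → w ≢ u
  childless-not-parent childless wv eq refl = childless (_ , wv , ≡.sym eq)

  module DepthProperties {r d} (isDepth : IsDepth r d) where

    up : Fin n → Fin n
    up v with v ≟ r
    ... | yes _  = r
    ... | no v≢r = proj₁ (has-parent isDepth v v≢r)

    depth-up : ∀ v → d (up v) ≡ d v ∸ 1
    depth-up v with v ≟ r
    ... | yes refl = trans (depth-root isDepth) (cong (_∸ 1) (≡.sym (depth-root isDepth)))
    ... | no v≢r   = cong (_∸ 1) (proj₂ (proj₂ (has-parent isDepth v v≢r)))

    ancestor : ℕ → Fin n → Fin n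
    ancestor zero    v = v
    ancestor (suc k) v = ancestor k (up v)

    depth-ancestor : ∀ k v → d (ancestor k v) ≡ d v ∸ k
    depth-ancestor zero    v = refl
    depth-ancestor (suc k) v = begin
      d (ancestor k (up v)) ≡⟨ depth-ancestor k (up v) ⟩
      d (up v) ∸ k          ≡⟨ cong (_∸ k) (depth-up v) ⟩
      d v ∸ 1 ∸ k           ≡⟨ ℕ.∸-+-assoc (d v) 1 k ⟩
      d v ∸ suc k           ∎
      where open ≡-Reasoning

    ancestorAt : ℕ → Fin n → Fin n
    ancestorAt j v = ancestor (d v ∸ j) v

    depth-ancestorAt : ∀ {j v} → j ≤ d v → d (ancestorAt j v) ≡ j
    depth-ancestorAt {j} {v} j≤dv = trans (depth-ancestor (d v ∸ j) v) (ℕ.m∸[m∸n]≡n j≤dv)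

    depth<n : ∀ v → d v < n
    depth<n v = Fin.injective⇒≤ {f = λ (i : Fin (suc (d v))) → ancestorAt (toℕ i) v} injective
      where
      depth-at : ∀ (i : Fin (suc (d v))) → d (ancestorAt (toℕ i) v) ≡ toℕ i
      depth-at i = depth-ancestorAt (Fin.toℕ≤pred[n] i)
      injective : ∀ {i j} → ancestorAt (toℕ i) v ≡ ancestorAt (toℕ j) v → i ≡ j
      injective {i} {j} eq = Fin.toℕ-injective
        (trans (≡.sym (depth-at i)) (trans (cong d eq) (depth-at j)))

    nonroot⇒depth≥1 : ∀ {v} → v ≢ r → 1 ≤ d v
    nonroot⇒depth≥1 {v} v≢r with has-parent isDepth v v≢r
    ... | _ , _ , eq = subst (1 ≤_) eq (s≤s z≤n)

    depth≡0⇒root : ∀ {v} → d v ≡ 0 → v ≡ r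
    depth≡0⇒root {v} dv≡0 with v ≟ r
    ... | yes v≡r = v≡r
    ... | no v≢r  = ⊥-elim (ℕ.<⇒≢ (nonroot⇒depth≥1 v≢r) (≡.sym dv≡0))

    root-has-depth-one-neighbour : ∀ {v} → v ≢ r → ∃ λ a → Adj G r a × d a ≡ 1
    root-has-depth-one-neighbour {v} v≢r =
      let (w , wa , dw+1≡da) = has-parent isDepth a a≢r
      in a , subst (λ x → Adj G x a) (depth≡0⇒root (ℕ.suc-injective (trans dw+1≡da da≡1))) wa , da≡1
      where
      a = ancestorAt 1 v
      da≡1 : d a ≡ 1
      da≡1 = depth-ancestorAt (nonroot⇒depth≥1 v≢r)
      a≢r : a ≢ r
      a≢r a≡r = ℕ.<⇒≢ (s≤s z≤n)
        (trans (≡.sym (depth-root isDepth)) (trans (cong d (≡.sym a≡r)) da≡1))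

    module DeepestPath {ℓ} (dℓ+1≡n : suc (d ℓ) ≡ n) where

      path : ℕ → Fin n
      path k = ancestorAt k ℓ

      depth-path : ∀ {k} → k < n → d (path k) ≡ k
      depth-path k<n = depth-ancestorAt (ℕ.≤-pred (subst (_ <_) (≡.sym dℓ+1≡n) k<n))

      -- The path already has n distinct vertices, so a vertex off it would be an (n+1)-st.
      path-depth : ∀ v → path (d v) ≡ v
      path-depth v with path (d v) ≟ v
      ... | yes on-path = on-path
      ... | no off-path = ⊥-elim (ℕ.<-irrefl refl (Fin.injective⇒≤ {f = extend} injective))
        where
        extend : Fin (suc n) → Fin n
        extend zero    = v
        extend (suc i) = path (toℕ i)
        depth-extend : ∀ i → d (path (toℕ i)) ≡ toℕ i
        depth-extend i = depth-path (Fin.toℕ<n i)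
        injective : ∀ {i j} → extend i ≡ extend j → i ≡ j
        injective {zero}  {zero}  _  = refl
        injective {suc i} {suc j} eq = cong suc (Fin.toℕ-injective
          (trans (≡.sym (depth-extend i)) (trans (cong d eq) (depth-extend j))))
        injective {zero}  {suc j} eq =
          ⊥-elim (off-path (trans (cong path (trans (cong d eq) (depth-extend j))) (≡.sym eq)))
        injective {suc i} {zero}  eq =
          ⊥-elim (off-path (trans (cong path (trans (cong d (≡.sym eq)) (depth-extend i))) eq))

      depth-injective : ∀ {u v} → d u ≡ d v → u ≡ v
      depth-injective {u} {v} eq = trans (≡.sym (path-depth u)) (trans (cong path eq) (path-depth v))

  open DepthProperties using (depth<n)

  raise : ∀ {r d} → IsDepth r d → ∀ {u w} → u ≢ r → ¬ HasChild d u → Adj G u w → d u ≤ d w →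
          ∃ λ d′ → IsDepth r d′ × sum d < sum d′
  raise {r} {d} isDepth {u} {w} u≢r childless uw du≤dw = d′ , isDepth′ , increases
    where
    d′ : Fin n → ℕ
    d′ = updateAt d u λ _ → suc (d w)
    unchanged : ∀ {x} → x ≢ u → d′ x ≡ d x
    unchanged x≢u = updateAt-minimal _ u d x≢u
    isDepth′ : IsDepth r d′
    isDepth′ .depth-root = trans (unchanged (u≢r ∘ ≡.sym)) (depth-root isDepth)
    isDepth′ .has-parent x x≢r with x ≟ u
    ... | yes refl = w , sym G uw ,
      trans (cong suc (unchanged (adj⇒≢ G uw ∘ ≡.sym))) (≡.sym (updateAt-updates u d))
    ... | no x≢u   = let (p , px , dp+1≡dx) = has-parent isDepth x x≢r in
      p , px , trans (cong suc (unchanged (childless-not-parent childless px dp+1≡dx)))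
                     (trans dp+1≡dx (≡.sym (unchanged x≢u)))
    increases : sum d < sum d′
    increases = m+n≡o+p∧n<p⇒o<m (sum-updateAt d u _) (s≤s du≤dw)

  reroot : ∀ {r d} → IsDepth r d → ∀ {ℓ} → ℓ ≢ r → ¬ HasChild d ℓ → Adj G r ℓ → suc (d ℓ) < n →
           ∃ λ d′ → IsDepth ℓ d′ × sum d < sum d′
  reroot {r} {d} isDepth {ℓ} ℓ≢r childless rℓ dℓ<n = d′ , isDepth′ , increases
    where
    d′ : Fin n → ℕ
    d′ = updateAt (suc ∘ d) ℓ λ _ → 0
    shifted : ∀ {x} → x ≢ ℓ → d′ x ≡ suc (d x)
    shifted x≢ℓ = updateAt-minimal _ ℓ (suc ∘ d) x≢ℓ
    isDepth′ : IsDepth ℓ d′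
    isDepth′ .depth-root = updateAt-updates ℓ (suc ∘ d)
    isDepth′ .has-parent x x≢ℓ with x ≟ r
    ... | yes refl = ℓ , sym G rℓ , trans
      (cong suc (trans (updateAt-updates ℓ (suc ∘ d)) (≡.sym (depth-root isDepth))))
      (≡.sym (shifted x≢ℓ))
    ... | no x≢r   = let (p , px , dp+1≡dx) = has-parent isDepth x x≢r in
      p , px , trans (cong suc (shifted (childless-not-parent childless px dp+1≡dx)))
                     (trans (cong suc dp+1≡dx) (≡.sym (shifted x≢ℓ)))
    increases : sum d < sum d′
    increases = m+n≡o+p∧n<p⇒o<m (begin
      sum d′ + suc (d ℓ)  ≡⟨ sum-updateAt (suc ∘ d) ℓ _ ⟩
      sum (suc ∘ d) + 0   ≡⟨ ℕ.+-identityʳ _ ⟩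
      sum (suc ∘ d)       ≡⟨ sum-suc d ⟩
      n + sum d           ≡⟨ ℕ.+-comm n (sum d) ⟩
      sum d + n           ∎) dℓ<n
      where open ≡-Reasoning

  record Stable : Set where
    field
      root    : Fin n
      depth   : Fin n → ℕ
      isDepth : IsDepth root depth
      leaf-neighbours-shallower : ∀ u → u ≢ root → ¬ HasChild depth u →
                                  ∀ w → Adj G u w → depth w < depth u
      leaf-at-root-deepest      : ∀ ℓ → ℓ ≢ root → ¬ HasChild depth ℓ → Adj G root ℓ →
                                  n ≤ suc (depth ℓ)

  -- Every move increases the sum of depths, which never exceeds n * n.
  stabiliseWithin : ∀ fuel {r d} → IsDepth r d → n * n < fuel + sum d → Stable
  stabiliseWithin zero {d = d} isDepth bound =
    ⊥-elim (ℕ.<⇒≱ bound (sum-≤ d n (ℕ.<⇒≤ ∘ depth<n isDepth)))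
  stabiliseWithin (suc fuel) {r} {d} isDepth bound
    with Fin.any? (λ u → Fin.any? λ w →
           ¬? (u ≟ r) ×-dec ¬? (hasChild? d u) ×-dec adj-dec G u w ×-dec (d u ≤? d w))
  ... | yes (u , w , u≢r , childless , uw , du≤dw) =
    let (d′ , isDepth′ , increases) = raise isDepth u≢r childless uw du≤dw
    in stabiliseWithin fuel isDepth′ (spend-fuel bound increases)
  ... | no ¬raisable
    with Fin.any? (λ ℓ →
           ¬? (ℓ ≟ r) ×-dec ¬? (hasChild? d ℓ) ×-dec adj-dec G r ℓ ×-dec (suc (d ℓ) <? n))
  ... | yes (ℓ , ℓ≢r , childless , rℓ , dℓ<n) =
    let (d′ , isDepth′ , increases) = reroot isDepth ℓ≢r childless rℓ dℓ<n
    in stabiliseWithin fuel isDepth′ (spend-fuel bound increases)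
  ... | no ¬rerootable = record
    { isDepth = isDepth
    ; leaf-neighbours-shallower = λ u u≢r childless w uw →
        ℕ.≰⇒> λ du≤dw → ¬raisable (u , w , u≢r , childless , uw , du≤dw)
    ; leaf-at-root-deepest = λ ℓ ℓ≢r childless rℓ →
        ℕ.≮⇒≥ λ dℓ<n → ¬rerootable (ℓ , ℓ≢r , childless , rℓ , dℓ<n)
    }

  stabilise : ∀ {r d} → IsDepth r d → Stable
  stabilise {d = d} isDepth = stabiliseWithin (suc (n * n)) isDepth (s≤s (ℕ.m≤m+n (n * n) (sum d)))

  WalkOfLength : Fin n → ℕ → Fin n → Set
  WalkOfLength r zero    v = v ≡ r
  WalkOfLength r (suc k) v = ∃ λ w → Adj G v w × WalkOfLength r k w

  walkOfLength? : ∀ r k v → Dec (WalkOfLength r k v)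
  walkOfLength? r zero    v = v ≟ r
  walkOfLength? r (suc k) v = Fin.any? λ w → adj-dec G v w ×-dec walkOfLength? r k w

  walkOfLength : ∀ {v r} → Walk G v r → ∃ λ k → WalkOfLength r k v
  walkOfLength here         = 0 , refl
  walkOfLength (step vw wr) = let (k , walk) = walkOfLength wr in suc k , _ , vw , walk

  distance-isDepth : Connected G → ∀ r → ∃ (IsDepth r)
  distance-isDepth connected r = distance , isDepth
    where
    shortest : ∀ v → ∃ λ k → WalkOfLength r k v × (∀ j → WalkOfLength r j v → k ≤ j)
    shortest v = least (λ k → walkOfLength? r k v) (proj₂ (walkOfLength (connected v r)))
    distance : Fin n → ℕ
    distance v = proj₁ (shortest v)
    isDepth : IsDepth r distance
    isDepth .depth-root = ℕ.n≤0⇒n≡0 (proj₂ (proj₂ (shortest r)) 0 refl)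
    isDepth .has-parent v v≢r with shortest v
    ... | zero  , v≡r , _ = ⊥-elim (v≢r v≡r)
    ... | suc k , (w , vw , walk) , minimal = w , sym G vw , ℕ.≤-antisym
      (s≤s (proj₂ (proj₂ (shortest w)) k walk))
      (minimal (suc (distance w)) (w , vw , proj₁ (proj₂ (shortest w))))

module StableColouring {n : ℕ} (G : Graph n) (stable : Depths.Stable G) where
  open Colourings G
  open Depths G
  open Stable stable
  open IsDepth isDepth
  open DepthProperties isDepth

  colour : Colouring
  colour = mod₃ ∘ depth

  data Kind (v : Fin n) : Set where
    the-root : v ≡ root → Kind v
    inner    : v ≢ root → HasChild depth v → Kind v
    leaf     : v ≢ root → ¬ HasChild depth v → Kind v

  kind : ∀ v → Kind v
  kind v with v ≟ root | hasChild? depth v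
  ... | yes v≡r | _         = the-root v≡r
  ... | no v≢r  | yes child = inner v≢r child
  ... | no v≢r  | no ¬child = leaf v≢r ¬child

  inner-seesAll : ∀ {v} → v ≢ root → HasChild depth v → SeesAll colour v
  inner-seesAll {v} v≢r (w , vw , dw≡dv+1) =
    let (p , pv , dp+1≡dv) = has-parent v v≢r
    in seesAll-cyclic (mod₃ (depth p))
         (sees-neighbour pv refl)
         (sees-self (cong mod₃ (≡.sym dp+1≡dv)))
         (sees-neighbour (sym G vw) (cong mod₃ (trans dw≡dv+1 (cong suc (≡.sym dp+1≡dv)))))

  root-sees-0-1 : ∀ {v} → v ≢ root → ∀ c → c ≢ 2F → Sees colour c root
  root-sees-0-1 v≢r 0F _ = sees-self (cong mod₃ depth-root)
  root-sees-0-1 v≢r 1F _ = let (a , ra , da≡1) = root-has-depth-one-neighbour v≢r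
                           in sees-neighbour (sym G ra) (cong mod₃ da≡1)
  root-sees-0-1 v≢r 2F c≢2 = ⊥-elim (c≢2 refl)

  -- The root sees colours 0 and 1, the leaf those of its parent and itself, so only
  -- colour 2 can be missed, and only when the depth of the leaf is 1 mod 3.
  leaf-root-edge : ∀ {ℓ} → ℓ ≢ root → Adj G root ℓ → mod₃ (depth ℓ) ≢ 1F →
                   ∀ c → Sees colour c root ⊎ Sees colour c ℓ
  leaf-root-edge {ℓ} ℓ≢r rℓ dℓ≢1 c with has-parent ℓ ℓ≢r
  ... | p , pℓ , dp+1≡dℓ with suc₃-cases (mod₃ (depth p)) c
  ... | inj₁ refl        = inj₂ (sees-neighbour pℓ refl)
  ... | inj₂ (inj₁ refl) = inj₂ (sees-self (cong mod₃ (≡.sym dp+1≡dℓ)))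
  ... | inj₂ (inj₂ c≡)   = inj₁ (root-sees-0-1 ℓ≢r c λ c≡2 → dℓ≢1 (suc₃-injective
          (trans (cong suc₃ (cong mod₃ (≡.sym dp+1≡dℓ))) (trans (≡.sym c≡) c≡2))))

  root-leaf-depth : ∀ {ℓ} → ℓ ≢ root → ¬ HasChild depth ℓ → Adj G root ℓ → suc (depth ℓ) ≡ n
  root-leaf-depth ℓ≢r ℓ-leaf rℓ = ℕ.≤-antisym (depth<n _) (leaf-at-root-deepest _ ℓ≢r ℓ-leaf rℓ)

  isolating : (∀ ℓ → Adj G root ℓ → suc (depth ℓ) ≡ n → mod₃ (depth ℓ) ≢ 1F) →
              IsolatingColouring colour
  isolating no-bad-cycle c u v uv with kind u | kind v
  ... | inner u≢r u-child | _ = inj₁ (inner-seesAll u≢r u-child c)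
  ... | _ | inner v≢r v-child = inj₂ (inner-seesAll v≢r v-child c)
  ... | the-root refl | the-root refl = ⊥-elim (irrefl G u uv)
  ... | the-root refl | leaf v≢r v-leaf =
    leaf-root-edge v≢r uv (no-bad-cycle v uv (root-leaf-depth v≢r v-leaf uv)) c
  ... | leaf u≢r u-leaf | the-root refl = let vu = sym G uv in
    swap (leaf-root-edge u≢r vu (no-bad-cycle u vu (root-leaf-depth u≢r u-leaf vu)) c)
  ... | leaf u≢r u-leaf | leaf v≢r v-leaf = ⊥-elim (ℕ.<-asym
    (leaf-neighbours-shallower u u≢r u-leaf v uv) (leaf-neighbours-shallower v v≢r v-leaf u (sym G uv)))

  isolating⊎hamiltonian : IsolatingColouring colour ⊎
                          ∃ λ ℓ → Adj G root ℓ × suc (depth ℓ) ≡ n × mod₃ (depth ℓ) ≡ 1F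
  isolating⊎hamiltonian
    with Fin.any? (λ ℓ → adj-dec G root ℓ ×-dec (suc (depth ℓ) ℕ.≟ n) ×-dec (mod₃ (depth ℓ) ≟ 1F))
  ... | yes bad = inj₂ bad
  ... | no ¬bad = inj₁ (isolating λ ℓ rℓ dℓ+1≡n dℓ≡1 → ¬bad (ℓ , rℓ , dℓ+1≡n , dℓ≡1))

module CyclePositions (n : ℕ) where

  Next : ℕ → ℕ → Set
  Next p q = suc p ≡ q ⊎ (suc p ≡ n × q ≡ 0)

  next? : ∀ p q → Dec (Next p q)
  next? p q = (suc p ℕ.≟ q) ⊎-dec ((suc p ℕ.≟ n) ×-dec (q ℕ.≟ 0))

  -- Position of p once the cycle is rotated to start at s.
  shift : ℕ → ℕ → ℕ
  shift s p with s ≤? p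
  ... | yes _ = p ∸ s
  ... | no  _ = (n ∸ s) + p

  unshift : ℕ → ℕ → ℕ
  unshift s k with k <? n ∸ s
  ... | yes _ = s + k
  ... | no  _ = k ∸ (n ∸ s)

  shift-≥ : ∀ {s p} → s ≤ p → shift s p ≡ p ∸ s
  shift-≥ {s} {p} s≤p with s ≤? p
  ... | yes _  = refl
  ... | no s≰p = ⊥-elim (s≰p s≤p)

  shift-< : ∀ {s p} → p < s → shift s p ≡ (n ∸ s) + p
  shift-< {s} {p} p<s with s ≤? p
  ... | yes s≤p = ⊥-elim (ℕ.<⇒≱ p<s s≤p)
  ... | no _    = refl

  shift-self : ∀ s → shift s s ≡ 0
  shift-self s = trans (shift-≥ {s} ℕ.≤-refl) (ℕ.n∸n≡0 s)

  module _ {s} (s<n : s < n) where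
    private
      A = n ∸ s

      A+s≡n : A + s ≡ n
      A+s≡n = ℕ.m∸n+n≡m (ℕ.<⇒≤ s<n)

      s+A≡n : s + A ≡ n
      s+A≡n = ℕ.m+[n∸m]≡n (ℕ.<⇒≤ s<n)

      A+q≢0 : ∀ q → A + q ≢ 0
      A+q≢0 q eq = ℕ.<⇒≢ (ℕ.<-≤-trans (ℕ.m<n⇒0<n∸m s<n) (ℕ.m≤m+n A q)) (≡.sym eq)

      p∸s<A : ∀ {p} → p < n → s ≤ p → p ∸ s < A
      p∸s<A p<n s≤p = ℕ.∸-monoˡ-< p<n s≤p

      q≡s : ∀ {q} → s ≤ q → q ∸ s ≡ 0 → q ≡ s
      q≡s s≤q q∸s≡0 = ℕ.≤-antisym (ℕ.m∸n≡0⇒m≤n q∸s≡0) s≤q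

      suc-via-s : ∀ {p a} → s ≤ p → suc (p ∸ s) ≡ a → suc p ≡ a + s
      suc-via-s {p} s≤p eq = trans (cong suc (≡.sym (ℕ.m∸n+n≡m s≤p))) (cong (_+ s) eq)

    shift<n : ∀ {p} → p < n → shift s p < n
    shift<n {p} p<n with s ≤? p
    ... | yes _   = ℕ.≤-<-trans (ℕ.m∸n≤m p s) p<n
    ... | no s≰p  = subst (A + p <_) A+s≡n (ℕ.+-monoʳ-< A (ℕ.≰⇒> s≰p))

    unshift<n : ∀ {k} → k < n → unshift s k < n
    unshift<n {k} k<n with k <? A
    ... | yes k<A = subst (s + k <_) s+A≡n (ℕ.+-monoʳ-< s k<A)
    ... | no _    = ℕ.≤-<-trans (ℕ.m∸n≤m k A) k<n

    shift-unshift : ∀ {k} → k < n → shift s (unshift s k) ≡ k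
    shift-unshift {k} k<n with k <? A
    ... | yes _   = trans (shift-≥ (ℕ.m≤m+n s k)) (ℕ.m+n∸m≡n s k)
    ... | no k≮A  = trans (shift-< k∸A<s) (ℕ.m+[n∸m]≡n (ℕ.≮⇒≥ k≮A))
      where
      k∸A<s : k ∸ A < s
      k∸A<s = subst (k ∸ A <_) (ℕ.m+n∸m≡n A s)
                (ℕ.∸-monoˡ-< (subst (k <_) (≡.sym A+s≡n) k<n) (ℕ.≮⇒≥ k≮A))

    unshift-shift : ∀ {p} → p < n → unshift s (shift s p) ≡ p
    unshift-shift {p} p<n with s ≤? p
    ... | yes s≤p with p ∸ s <? A
    ...   | yes _     = ℕ.m+[n∸m]≡n s≤p
    ...   | no p∸s≮A = ⊥-elim (p∸s≮A (p∸s<A p<n s≤p))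
    unshift-shift {p} p<n | no _ with A + p <? A
    ...   | yes A+p<A = ⊥-elim (ℕ.m+n≮m A p A+p<A)
    ...   | no _      = ℕ.m+n∸m≡n A p

    shift-next : ∀ {p q} → p < n → q < n → Next (shift s p) (shift s q) → Next p q
    shift-next {p} {q} p<n q<n next with s ≤? p | s ≤? q | next
    ... | yes s≤p | yes s≤q | inj₁ eq = inj₁ (trans (suc-via-s s≤p eq) (ℕ.m∸n+n≡m s≤q))
    ... | yes s≤p | yes s≤q | inj₂ (eq , q∸s≡0) =
      inj₂ (trans p+1≡n+s (trans (cong (n +_) s≡0) (ℕ.+-identityʳ n)) , trans (q≡s s≤q q∸s≡0) s≡0)
      where
      p+1≡n+s : suc p ≡ n + s
      p+1≡n+s = suc-via-s s≤p eq
      s≡0 : s ≡ 0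
      s≡0 = ℕ.n≤0⇒n≡0 (ℕ.+-cancelˡ-≤ n s 0
              (≡.subst₂ _≤_ p+1≡n+s (≡.sym (ℕ.+-identityʳ n)) p<n))
    ... | yes s≤p | no s≰q  | inj₁ eq =
      inj₂ (trans (suc-via-s s≤p eq) (trans (cong (_+ s) A+q≡A) A+s≡n) , q≡0)
      where
      q≡0 : q ≡ 0
      q≡0 = ℕ.n≤0⇒n≡0 (ℕ.+-cancelˡ-≤ A q 0
              (≡.subst₂ _≤_ eq (≡.sym (ℕ.+-identityʳ A)) (p∸s<A p<n s≤p)))
      A+q≡A : A + q ≡ A
      A+q≡A = trans (cong (A +_) q≡0) (ℕ.+-identityʳ A)
    ... | yes _   | no _    | inj₂ (_ , A+q≡0) = ⊥-elim (A+q≢0 q A+q≡0)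
    ... | no s≰p  | yes s≤q | inj₁ eq =
      ⊥-elim (ℕ.<-asym (p∸s<A q<n s≤q) (subst (A <_) eq (s≤s (ℕ.m≤m+n A p))))
    ... | no s≰p  | yes s≤q | inj₂ (eq , q∸s≡0) = inj₁ (trans
      (ℕ.+-cancelˡ-≡ A _ _ (trans (ℕ.+-suc A p) (trans eq (≡.sym A+s≡n))))
      (≡.sym (q≡s s≤q q∸s≡0)))
    ... | no _    | no _    | inj₁ eq = inj₁ (ℕ.+-cancelˡ-≡ A _ _ (trans (ℕ.+-suc A p) eq))
    ... | no _    | no _    | inj₂ (_ , A+q≡0) = ⊥-elim (A+q≢0 q A+q≡0)

  reverse₁₋₄ : ℕ → ℕ
  reverse₁₋₄ 1 = 4
  reverse₁₋₄ 2 = 3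
  reverse₁₋₄ 3 = 2
  reverse₁₋₄ 4 = 1
  reverse₁₋₄ k = k

  reverse₁₋₄-involutive : ∀ k → reverse₁₋₄ (reverse₁₋₄ k) ≡ k
  reverse₁₋₄-involutive 0 = refl
  reverse₁₋₄-involutive 1 = refl
  reverse₁₋₄-involutive 2 = refl
  reverse₁₋₄-involutive 3 = refl
  reverse₁₋₄-involutive 4 = refl
  reverse₁₋₄-involutive (suc (suc (suc (suc (suc k))))) = refl

  reverse₁₋₄<n : ∀ {k} → 4 < n → k < n → reverse₁₋₄ k < n
  reverse₁₋₄<n {0} _   k<n = k<n
  reverse₁₋₄<n {1} 4<n _   = 4<n
  reverse₁₋₄<n {2} 4<n _   = ℕ.<-trans (ℕ.n<1+n 3) 4<n
  reverse₁₋₄<n {3} 4<n _   = ℕ.<-trans (s≤s (s≤s (s≤s z≤n))) 4<n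
  reverse₁₋₄<n {4} _   k<n = ℕ.<-trans (s≤s (s≤s z≤n)) k<n
  reverse₁₋₄<n {suc (suc (suc (suc (suc k))))} _ k<n = k<n

  reverse₁₋₄-step : ∀ p → let q = reverse₁₋₄ (suc (reverse₁₋₄ p)) in
                    Next p q ⊎ Next q p ⊎ (p ≡ 0 × q ≡ 4) ⊎ (p ≡ 1 × q ≡ 5)
  reverse₁₋₄-step 0 = inj₂ (inj₂ (inj₁ (refl , refl)))
  reverse₁₋₄-step 1 = inj₂ (inj₂ (inj₂ (refl , refl)))
  reverse₁₋₄-step 2 = inj₂ (inj₁ (inj₁ refl))
  reverse₁₋₄-step 3 = inj₂ (inj₁ (inj₁ refl))
  reverse₁₋₄-step 4 = inj₂ (inj₁ (inj₁ refl))
  reverse₁₋₄-step (suc (suc (suc (suc (suc k))))) = inj₁ (inj₁ refl)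

  reverse₁₋₄-next : ∀ {p q} → 5 < n → Next (reverse₁₋₄ p) (reverse₁₋₄ q) →
                    Next p q ⊎ Next q p ⊎ (p ≡ 0 × q ≡ 4) ⊎ (p ≡ 1 × q ≡ 5)
  reverse₁₋₄-next {p} {q} _ (inj₁ eq) =
    subst (λ q → Next p q ⊎ Next q p ⊎ (p ≡ 0 × q ≡ 4) ⊎ (p ≡ 1 × q ≡ 5))
      (trans (cong reverse₁₋₄ eq) (reverse₁₋₄-involutive q)) (reverse₁₋₄-step p)
  reverse₁₋₄-next {p} {q} 5<n (inj₂ (eq , q′≡0)) = inj₁ (inj₂ (trans (cong suc p≡p′) eq , q≡0))
    where
    q≡0 : q ≡ 0
    q≡0 = trans (≡.sym (reverse₁₋₄-involutive q)) (cong reverse₁₋₄ q′≡0)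
    fixed : ∀ {k} → 5 ≤ k → reverse₁₋₄ k ≡ k
    fixed (s≤s (s≤s (s≤s (s≤s (s≤s _))))) = refl
    p≡p′ : p ≡ reverse₁₋₄ p
    p≡p′ = trans (≡.sym (reverse₁₋₄-involutive p))
                 (fixed (ℕ.≤-pred (subst (5 <_) (≡.sym eq) 5<n)))

-- Depth of position k in the spanning tree of a (K + 4)-cycle made of the arcs 0, 1, …, K
-- and 0, K + 3, K + 2, K + 1.
arcDepth : ℕ → ℕ → ℕ
arcDepth K k with k ≤? K
... | yes _ = k
... | no  _ = (4 + K) ∸ k

arcDepth-≤ : ∀ {K k} → k ≤ K → arcDepth K k ≡ k
arcDepth-≤ {K} {k} k≤K with k ≤? K
... | yes _  = refl
... | no k≰K = ⊥-elim (k≰K k≤K)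

arcDepth-beyond : ∀ {K} i → arcDepth K (suc i + K) ≡ 3 ∸ i
arcDepth-beyond {K} i with suc i + K ≤? K
... | yes i+K<K = ⊥-elim (ℕ.m+n≮n i K i+K<K)
... | no _      = trans (≡.cong₂ _∸_ (ℕ.+-comm 3 K) (ℕ.+-comm i K)) (ℕ.[m+n]∸[m+o]≡n∸o K 3 i)

data ArcPosition (K : ℕ) : ℕ → Set where
  start  : ArcPosition K 0
  inner  : ∀ {k} → suc k < K → ArcPosition K (suc k)
  end    : ArcPosition K K
  beyond : ∀ {i} → i < 3 → ArcPosition K (suc i + K)

arcPosition : ∀ K {p} → p < 4 + K → ArcPosition K p
arcPosition K {p} p<4+K with ℕ.<-cmp p K
... | tri< p<K _ _ = below p<K
  where
  below : ∀ {p} → p < K → ArcPosition K p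
  below {zero}  _   = start
  below {suc k} p<K = inner p<K
... | tri≈ _ refl _ = end
... | tri> _ _ K<p  = subst (ArcPosition K) i+1+K≡p (beyond i<3)
  where
  i = p ∸ suc K
  i+1+K≡p : suc i + K ≡ p
  i+1+K≡p = trans (≡.sym (ℕ.+-suc i K)) (ℕ.m∸n+n≡m K<p)
  i<3 : i < 3
  i<3 = subst (i <_) (ℕ.m+n∸n≡m 3 K) (ℕ.∸-monoˡ-< p<4+K K<p)

module HamiltonianCycles {n : ℕ} (G : Graph n) where
  open CyclePositions n
  open Colourings G
  open Depths G

  record HamiltonianCycle : Set where
    field
      pos      : Fin n → ℕ
      pos<n    : ∀ v → pos v < n
      at       : ℕ → Fin n
      pos-at   : ∀ {k} → k < n → pos (at k) ≡ k
      at-pos   : ∀ v → at (pos v) ≡ v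
      adj-next : ∀ {u v} → Next (pos u) (pos v) → Adj G u v

    pos-injective : ∀ {u v} → pos u ≡ pos v → u ≡ v
    pos-injective {u} {v} eq = trans (≡.sym (at-pos u)) (trans (cong at eq) (at-pos v))

    at-unique : ∀ {v k} → pos v ≡ k → v ≡ at k
    at-unique {v} eq = trans (≡.sym (at-pos v)) (cong at eq)

  open HamiltonianCycle

  fromDepth : ∀ {r d ℓ} → IsDepth r d → Adj G r ℓ → suc (d ℓ) ≡ n → HamiltonianCycle
  fromDepth {r} {d} {ℓ} isDepth rℓ dℓ+1≡n = record
    { pos = d ; pos<n = depth<n ; at = path ; pos-at = depth-path ; at-pos = path-depth
    ; adj-next = adj-next′ }
    where
    open IsDepth isDepth
    open DepthProperties isDepth
    open DeepestPath dℓ+1≡n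
    adj-next′ : ∀ {u v} → Next (d u) (d v) → Adj G u v
    adj-next′ {u} {v} (inj₁ du+1≡dv) with v ≟ r
    ... | yes refl = ⊥-elim (ℕ.<⇒≢ (s≤s z≤n) (≡.sym (trans du+1≡dv depth-root)))
    ... | no v≢r   = let (p , pv , dp+1≡dv) = has-parent v v≢r in
      subst (λ x → Adj G x v) (depth-injective (ℕ.suc-injective (trans dp+1≡dv (≡.sym du+1≡dv)))) pv
    adj-next′ {u} {v} (inj₂ (du+1≡n , dv≡0)) =
      subst₂ (Adj G) (depth-injective (ℕ.suc-injective (trans dℓ+1≡n (≡.sym du+1≡n))))
                     (≡.sym (depth≡0⇒root dv≡0)) (sym G rℓ)

  rotate : HamiltonianCycle → ∀ {s} → s < n → HamiltonianCycle
  rotate H {s} s<n = record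
    { pos      = shift s ∘ pos H
    ; pos<n    = shift<n s<n ∘ pos<n H
    ; at       = at H ∘ unshift s
    ; pos-at   = λ k<n → trans (cong (shift s) (pos-at H (unshift<n s<n k<n))) (shift-unshift s<n k<n)
    ; at-pos   = λ v → trans (cong (at H) (unshift-shift s<n (pos<n H v))) (at-pos H v)
    ; adj-next = λ {u} {v} next → adj-next H (shift-next s<n (pos<n H u) (pos<n H v) next)
    }

  -- The chords 0–4 and 1–5 let the cycle be traversed as 0, 4, 3, 2, 1, 5, 6, …
  reorder : (H : HamiltonianCycle) → 5 < n → Adj G (at H 0) (at H 4) → Adj G (at H 1) (at H 5) →
            HamiltonianCycle
  reorder H 5<n chord₀₄ chord₁₅ = record
    { pos      = reverse₁₋₄ ∘ pos H
    ; pos<n    = reverse₁₋₄<n 4<n ∘ pos<n H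
    ; at       = at H ∘ reverse₁₋₄
    ; pos-at   = λ {k} k<n →
        trans (cong reverse₁₋₄ (pos-at H (reverse₁₋₄<n 4<n k<n))) (reverse₁₋₄-involutive k)
    ; at-pos   = λ v → trans (cong (at H) (reverse₁₋₄-involutive (pos H v))) (at-pos H v)
    ; adj-next = adj-next′
    }
    where
    4<n : 4 < n
    4<n = ℕ.<-trans (ℕ.n<1+n 4) 5<n
    adj-next′ : ∀ {u v} → Next (reverse₁₋₄ (pos H u)) (reverse₁₋₄ (pos H v)) → Adj G u v
    adj-next′ {u} {v} next with reverse₁₋₄-next 5<n next
    ... | inj₁ forward                    = adj-next H forward
    ... | inj₂ (inj₁ backward)            = sym G (adj-next H backward)
    ... | inj₂ (inj₂ (inj₁ (u≡0 , v≡4))) =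
      subst₂ (Adj G) (≡.sym (at-unique H u≡0)) (≡.sym (at-unique H v≡4)) chord₀₄
    ... | inj₂ (inj₂ (inj₂ (u≡1 , v≡5))) =
      subst₂ (Adj G) (≡.sym (at-unique H u≡1)) (≡.sym (at-unique H v≡5)) chord₁₅

  module PositionColouring (H : HamiltonianCycle) (f : ℕ → Fin 3) where

    colour : Colouring
    colour = f ∘ pos H

    sees-at : ∀ {v k c} → pos H v ≡ k → f k ≡ c → Sees colour c v
    sees-at eq fk≡c = sees-self (trans (cong f eq) fk≡c)

    sees-before : ∀ {v k c} → pos H v ≡ suc k → f k ≡ c → Sees colour c v
    sees-before {v} {k} eq fk≡c =
      sees-neighbour (adj-next H (inj₁ (trans (cong suc (pos-at H k<n)) (≡.sym eq))))
                     (trans (cong f (pos-at H k<n)) fk≡c)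
      where
      k<n : k < n
      k<n = ℕ.<-trans (ℕ.n<1+n k) (subst (_< n) eq (pos<n H v))

    sees-after : ∀ {v k c} → pos H v ≡ k → suc k < n → f (suc k) ≡ c → Sees colour c v
    sees-after eq k+1<n fk+1≡c =
      sees-neighbour (sym G (adj-next H (inj₁ (trans (cong suc eq) (≡.sym (pos-at H k+1<n))))))
                     (trans (cong f (pos-at H k+1<n)) fk+1≡c)

    sees-wrap : ∀ {v k c} → pos H v ≡ k → suc k ≡ n → f 0 ≡ c → Sees colour c v
    sees-wrap eq k+1≡n f0≡c =
      sees-neighbour (sym G (adj-next H (inj₂ (trans (cong suc eq) k+1≡n , pos-at H 0<n))))
                     (trans (cong f (pos-at H 0<n)) f0≡c)
      where
      0<n : 0 < n
      0<n = subst (0 <_) k+1≡n (s≤s z≤n)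

  residue-colouring : (H : HamiltonianCycle) → ∀ {x w} → pos H x ≡ 0 → Adj G w x → mod₃ (pos H w) ≡ 2F →
                      IsolatingColouring (mod₃ ∘ pos H)
  residue-colouring H {x} {w} x-first wx w-2 =
    isolating-from-independent-exceptions _ Last seesAll-or-last last-independent
    where
    open PositionColouring H mod₃
    Last : Fin n → Set
    Last v = suc (pos H v) ≡ n
    last-independent : ∀ u v → Adj G u v → Last u → Last v → ⊥
    last-independent u v uv u-last v-last =
      adj⇒≢ G uv (pos-injective H (ℕ.suc-injective (trans u-last (≡.sym v-last))))
    seesAll-at : ∀ {v k} → pos H v ≡ k → suc k < n → SeesAll colour v
    seesAll-at {v} {zero} eq 1<n = seesAll-cyclic 0F (sees-at eq refl) (sees-after eq 1<n refl)
      (sees-neighbour (subst (Adj G w) (pos-injective H (trans x-first (≡.sym eq))) wx) w-2)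
    seesAll-at {v} {suc k} eq k+2<n =
      seesAll-cyclic (mod₃ k) (sees-before eq refl) (sees-at eq refl) (sees-after eq k+2<n refl)
    seesAll-or-last : ∀ v → SeesAll colour v ⊎ Last v
    seesAll-or-last v with suc (pos H v) ℕ.≟ n
    ... | yes last = inj₂ last
    ... | no ¬last = inj₁ (seesAll-at refl (ℕ.≤∧≢⇒< (pos<n H v) ¬last))

  arc-colouring : (H : HamiltonianCycle) → ∀ {K} → 4 + K ≡ n → mod₃ K ≡ 1F →
                  ∀ {u v} → pos H u ≡ 0 → pos H v ≡ K → ¬ Adj G u v →
                  IsolatingColouring (mod₃ ∘ arcDepth K ∘ pos H)
  arc-colouring H {K} K+4≡n K≡1 {u} {v} u-start v-end ¬uv =
    isolating-from-independent-exceptions _ End seesAll-or-end ends-independent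
    where
    open PositionColouring H (mod₃ ∘ arcDepth K)
    End : Fin n → Set
    End x = pos H x ≡ 0 ⊎ pos H x ≡ K
    ends-independent : ∀ x y → Adj G x y → End x → End y → ⊥
    ends-independent x y xy (inj₁ x0) (inj₁ y0) = adj⇒≢ G xy (pos-injective H (trans x0 (≡.sym y0)))
    ends-independent x y xy (inj₂ xK) (inj₂ yK) = adj⇒≢ G xy (pos-injective H (trans xK (≡.sym yK)))
    ends-independent x y xy (inj₁ x0) (inj₂ yK) = ¬uv (subst₂ (Adj G)
      (pos-injective H (trans x0 (≡.sym u-start))) (pos-injective H (trans yK (≡.sym v-end))) xy)
    ends-independent x y xy (inj₂ xK) (inj₁ y0) = ¬uv (subst₂ (Adj G)
      (pos-injective H (trans y0 (≡.sym u-start))) (pos-injective H (trans xK (≡.sym v-end))) (sym G xy))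
    +K<n : ∀ {m} → m < 4 → m + K < n
    +K<n m<4 = subst (_ <_) K+4≡n (ℕ.+-monoˡ-< K m<4)
    depth-≤ : ∀ {k} → k ≤ K → mod₃ (arcDepth K k) ≡ mod₃ k
    depth-≤ k≤K = cong mod₃ (arcDepth-≤ k≤K)
    depth-beyond : ∀ i → mod₃ (arcDepth K (suc i + K)) ≡ mod₃ (3 ∸ i)
    depth-beyond i = cong mod₃ (arcDepth-beyond {K} i)
    seesAll-at : ∀ {x p} → pos H x ≡ p → ArcPosition K p → SeesAll colour x ⊎ End x
    seesAll-at eq start = inj₂ (inj₁ eq)
    seesAll-at eq end   = inj₂ (inj₂ eq)
    seesAll-at {p = suc k} eq (inner k+1<K) = inj₁ (seesAll-cyclic (mod₃ k)
      (sees-before eq (depth-≤ (ℕ.<⇒≤ (ℕ.<-trans (ℕ.n<1+n k) k+1<K))))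
      (sees-at eq (depth-≤ (ℕ.<⇒≤ k+1<K)))
      (sees-after eq (ℕ.≤-<-trans k+1<K (+K<n {0} (s≤s z≤n))) (depth-≤ k+1<K)))
    seesAll-at eq (beyond {0} _) = inj₁ (seesAll-cyclic 0F
      (sees-at eq (depth-beyond 0))
      (sees-before eq (trans (depth-≤ ℕ.≤-refl) K≡1))
      (sees-after eq (+K<n {2} (s≤s (s≤s (s≤s z≤n)))) (depth-beyond 1)))
    seesAll-at eq (beyond {1} _) = inj₁ (seesAll-cyclic 0F
      (sees-before eq (depth-beyond 0))
      (sees-after eq (+K<n {3} ℕ.≤-refl) (depth-beyond 2))
      (sees-at eq (depth-beyond 1)))
    seesAll-at eq (beyond {2} _) = inj₁ (seesAll-cyclic 0F
      (sees-wrap eq K+4≡n (depth-≤ z≤n))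
      (sees-at eq (depth-beyond 2))
      (sees-before eq (depth-beyond 1)))
    seesAll-at eq (beyond {suc (suc (suc _))} (s≤s (s≤s (s≤s ()))))
    seesAll-or-end : ∀ x → SeesAll colour x ⊎ End x
    seesAll-or-end x = seesAll-at refl (arcPosition K (subst (_ <_) (≡.sym K+4≡n) (pos<n H x)))

module Isomorphisms {n : ℕ} (G : Graph n) where
  open CyclePositions n
  open HamiltonianCycles G
  open HamiltonianCycle

  position : HamiltonianCycle → Fin n → Fin n
  position H v = fromℕ< (pos<n H v)

  toℕ-position : ∀ H v → toℕ (position H v) ≡ pos H v
  toℕ-position H v = Fin.toℕ-fromℕ< (pos<n H v)

  position-injective : ∀ H {u v} → position H u ≡ position H v → u ≡ v
  position-injective H eq = pos-injective H (Fin.fromℕ<-injective _ _ (pos<n H _) (pos<n H _) eq)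

  ≅-byPositions : (H : HamiltonianCycle) (C : Graph n) →
    (∀ {u v} → Adj G u v → Adj C (position H u) (position H v)) →
    (∀ i j → Adj C i j → Next (toℕ i) (toℕ j) ⊎ Next (toℕ j) (toℕ i)) → G ≅ C
  ≅-byPositions H C adj⇒adj adj⇒next = record
    { bij  = mk⤖ {to = position H} (position-injective H , surjective)
    ; pres = λ u v → adj⇒adj , adj′⇒adj
    }
    where
    surjective : ∀ i → ∃ λ v → ∀ {z} → z ≡ v → position H z ≡ i
    surjective i = at H (toℕ i) , λ { refl → trans
      (Fin.fromℕ<-cong _ _ (pos-at H (Fin.toℕ<n i)) _ (Fin.toℕ<n i)) (Fin.fromℕ<-toℕ i (Fin.toℕ<n i)) }
    adj′⇒adj : ∀ {u v} → Adj C (position H u) (position H v) → Adj G u v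
    adj′⇒adj {u} {v} uv with adj⇒next _ _ uv
    ... | inj₁ next = adj-next H (subst₂ Next (toℕ-position H u) (toℕ-position H v) next)
    ... | inj₂ next = sym G (adj-next H (subst₂ Next (toℕ-position H v) (toℕ-position H u) next))

module _ where
  open CyclePositions 2 using (Next; next?)

  k₂-next : ∀ i j → Adj K₂ i j → Next (toℕ i) (toℕ j) ⊎ Next (toℕ j) (toℕ i)
  k₂-next = toWitness {a? = Fin.all? λ i → Fin.all? λ j →
    ¬? (i ≟ j) →-dec (next? (toℕ i) (toℕ j) ⊎-dec next? (toℕ j) (toℕ i))} _

module _ where
  open CyclePositions 5 using (Next; next?; shift)

  c₅-next : ∀ i j → Adj C₅ i j → Next (toℕ i) (toℕ j) ⊎ Next (toℕ j) (toℕ i)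
  c₅-next = toWitness {a? = Fin.all? λ i → Fin.all? λ j →
    adj-dec C₅ i j →-dec (next? (toℕ i) (toℕ j) ⊎-dec next? (toℕ j) (toℕ i))} _

  c₅-chordless : ∀ i j → i ≢ j → shift (toℕ i) (toℕ j) ≢ 2 → shift (toℕ j) (toℕ i) ≢ 2 → Adj C₅ i j
  c₅-chordless = toWitness {a? = Fin.all? λ i → Fin.all? λ j →
    ¬? (i ≟ j) →-dec ¬? (shift (toℕ i) (toℕ j) ℕ.≟ 2) →-dec ¬? (shift (toℕ j) (toℕ i) ℕ.≟ 2) →-dec
    adj-dec C₅ i j} _

open HamiltonianCycles using (HamiltonianCycle)
open HamiltonianCycles.HamiltonianCycle

module _ (G : Graph 2) (H : HamiltonianCycle G) where
  open Isomorphisms G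

  two-cycle : G ≅ K₂
  two-cycle = ≅-byPositions H K₂ (λ uv eq → adj⇒≢ G uv (position-injective H eq)) k₂-next

module _ (G : Graph 5) (H : HamiltonianCycle G) where
  open CyclePositions 5
  open HamiltonianCycles G
  open Isomorphisms G

  -- On five vertices, an edge off the cycle joins two vertices two steps apart.
  Chord : Fin 5 → Fin 5 → Set
  Chord u w = Adj G u w × shift (pos H u) (pos H w) ≡ 2

  chord? : ∀ u w → Dec (Chord u w)
  chord? u w = adj-dec G u w ×-dec (shift (pos H u) (pos H w) ℕ.≟ 2)

  chordless-≅C₅ : (∀ u w → ¬ Chord u w) → G ≅ C₅
  chordless-≅C₅ ¬chord = ≅-byPositions H C₅ c₅-adj c₅-next
    where
    shift-position : ∀ u v →
      shift (toℕ (position H u)) (toℕ (position H v)) ≡ shift (pos H u) (pos H v)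
    shift-position u v = ≡.cong₂ shift (toℕ-position H u) (toℕ-position H v)
    c₅-adj : ∀ {u v} → Adj G u v → Adj C₅ (position H u) (position H v)
    c₅-adj {u} {v} uv = c₅-chordless _ _ (adj⇒≢ G uv ∘ position-injective H)
      (λ eq → ¬chord u v (uv , trans (≡.sym (shift-position u v)) eq))
      (λ eq → ¬chord v u (sym G uv , trans (≡.sym (shift-position v u)) eq))

  five-cycle : HasIsolatingColouring G ⊎ G ≅ C₅
  five-cycle with Fin.any? (λ u → Fin.any? (chord? u))
  ... | yes (u , w , uw , w-at-2) =
    inj₁ (_ , residue-colouring (rotate H (pos<n H u)) (shift-self (pos H u)) (sym G uw) (cong mod₃ w-at-2))
  ... | no ¬chord = inj₂ (chordless-≅C₅ λ u w chord → ¬chord (u , w , chord))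

module _ {j} (G : Graph (8 + j)) (H : HamiltonianCycle G) (n≡2 : mod₃ (8 + j) ≡ 2F) where
  open CyclePositions (8 + j)
  open HamiltonianCycles G

  private
    K = 4 + j

    j+2≡2 : mod₃ (2 + j) ≡ 2F
    j+2≡2 = trans (≡.sym (trans (mod₃-3+ (5 + j)) (mod₃-3+ (2 + j)))) n≡2

    K≡1 : mod₃ K ≡ 1F
    K≡1 = trans (mod₃-3+ (1 + j)) (suc₃-injective j+2≡2)

    small : ∀ {k} → k ≤ 7 → k < 8 + j
    small k≤7 = s≤s (ℕ.≤-trans k≤7 (ℕ.m≤m+n 7 j))

  missing-distance-4-chord : ∀ {t} → t ≤ 2 → ¬ Adj G (at H t) (at H (4 + t)) → HasIsolatingColouring G
  missing-distance-4-chord {t} t≤2 ¬chord =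
    _ , arc-colouring (rotate H s<n) {K} refl K≡1 u-first v-at-K (¬chord ∘ sym G)
    where
    s<n : 4 + t < 8 + j
    s<n = small (s≤s (s≤s (s≤s (s≤s (ℕ.≤-trans t≤2 (ℕ.n≤1+n 2))))))
    u-first : shift (4 + t) (pos H (at H (4 + t))) ≡ 0
    u-first = trans (cong (shift (4 + t)) (pos-at H s<n)) (shift-self (4 + t))
    v-at-K : shift (4 + t) (pos H (at H t)) ≡ K
    v-at-K = begin
      shift (4 + t) (pos H (at H t))
        ≡⟨ cong (shift (4 + t)) (pos-at H (ℕ.≤-<-trans (ℕ.m≤n+m t 4) s<n)) ⟩
      shift (4 + t) t   ≡⟨ shift-< (ℕ.m<n+m t (s≤s z≤n)) ⟩
      ((4 + j) ∸ t) + t ≡⟨ ℕ.m∸n+n≡m (ℕ.≤-trans t≤2 (ℕ.m≤m+n 2 (2 + j))) ⟩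
      K                 ∎
      where open ≡-Reasoning

  long-cycle : HasIsolatingColouring G
  long-cycle with adj-dec G (at H 0) (at H 4) | adj-dec G (at H 1) (at H 5) | adj-dec G (at H 2) (at H 6)
  ... | no ¬chord₀₄ | _           | _           = missing-distance-4-chord {0} z≤n ¬chord₀₄
  ... | yes _       | no ¬chord₁₅ | _           = missing-distance-4-chord {1} (s≤s z≤n) ¬chord₁₅
  ... | yes _       | yes _       | no ¬chord₂₆ = missing-distance-4-chord {2} (s≤s (s≤s z≤n)) ¬chord₂₆
  ... | yes chord₀₄ | yes chord₁₅ | yes chord₂₆ =
    _ , residue-colouring H′ {at H 6} {at H 2} six-first chord₂₆ two-coloured-2
    where
    H′ = rotate (reorder H (small (ℕ.m≤m+n 5 2)) chord₀₄ chord₁₅) (small (ℕ.m≤m+n 6 1))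
    six-first : pos H′ (at H 6) ≡ 0
    six-first = trans (cong (shift 6 ∘ reverse₁₋₄) (pos-at H (small (ℕ.m≤m+n 6 1)))) (shift-self 6)
    -- Vertex 2 now sits at position n − 3.
    two-coloured-2 : mod₃ (pos H′ (at H 2)) ≡ 2F
    two-coloured-2 = begin
      mod₃ (shift 6 (reverse₁₋₄ (pos H (at H 2))))
        ≡⟨ cong (mod₃ ∘ shift 6 ∘ reverse₁₋₄) (pos-at H (small (ℕ.m≤m+n 2 5))) ⟩
      mod₃ ((2 + j) + 3) ≡⟨ cong mod₃ (ℕ.+-comm (2 + j) 3) ⟩
      mod₃ (3 + (2 + j)) ≡⟨ mod₃-3+ (2 + j) ⟩
      mod₃ (2 + j)       ≡⟨ j+2≡2 ⟩
      2F                 ∎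
      where open ≡-Reasoning

hamiltonian-case : ∀ {n} (G : Graph n) → HamiltonianCycle G → mod₃ n ≡ 2F →
                   HasIsolatingColouring G ⊎ G ≅ K₂ ⊎ G ≅ C₅
hamiltonian-case {0} G H ()
hamiltonian-case {1} G H ()
hamiltonian-case {2} G H _ = inj₂ (inj₁ (two-cycle G H))
hamiltonian-case {3} G H ()
hamiltonian-case {4} G H ()
hamiltonian-case {5} G H _ = map₂ inj₂ (five-cycle G H)
hamiltonian-case {6} G H ()
hamiltonian-case {7} G H ()
hamiltonian-case {suc (suc (suc (suc (suc (suc (suc (suc j)))))))} G H n≡2 = inj₁ (long-cycle G H n≡2)

stable-case : ∀ {n} (G : Graph n) → Depths.Stable G → HasIsolatingColouring G ⊎ G ≅ K₂ ⊎ G ≅ C₅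
stable-case G stable with StableColouring.isolating⊎hamiltonian G stable
... | inj₁ isolating = inj₁ (_ , isolating)
... | inj₂ (ℓ , rℓ , dℓ+1≡n , dℓ≡1) =
  hamiltonian-case G (HamiltonianCycles.fromDepth G (Depths.Stable.isDepth stable) rℓ dℓ+1≡n)
                   (subst (λ k → mod₃ k ≡ 2F) dℓ+1≡n (cong suc₃ dℓ≡1))

isolatingColouring : ∀ {n} (G : Graph n) → Connected G → ¬ G ≅ K₂ → ¬ G ≅ C₅ → HasIsolatingColouring G
isolatingColouring {zero}  G _ _ _ = (λ ()) , λ _ ()
isolatingColouring {suc m} G connected ¬K₂ ¬C₅
  with stable-case G (Depths.stabilise G (proj₂ (Depths.distance-isDepth G connected zero)))
... | inj₁ colouring    = colouring
... | inj₂ (inj₁ G≅K₂) = ⊥-elim (¬K₂ G≅K₂)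
... | inj₂ (inj₂ G≅C₅) = ⊥-elim (¬C₅ G≅C₅)

mainTheorem2 : (n : ℕ) (G : Graph n) → Connected G → ¬ (G ≅ K₂) → ¬ (G ≅ C₅) →
    Σ (Subset n) λ A → Σ (Subset n) λ B → Σ (Subset n) λ C →
      Isolating G A × Isolating G B × Isolating G C ×
      Disjoint A B × Disjoint A C × Disjoint B C
mainTheorem2 n G connected ¬K₂ ¬C₅ =
  Colourings.disjointIsolatingTriple G (proj₂ (isolatingColouring G connected ¬K₂ ¬C₅))
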